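{- If \(G\) is a regular graph that is a minimal counterexample to the Erd\H{o}s--Gy\'arf\'as conjecture (as defined in the context), then \(G\) is cubic, i.e. every vertex of \(G\) has degree \(3\).
   Context: All graphs are finite, simple and undirected. For a graph \(G\), \(\delta(G)\) denotes its minimum degree; \(G\) is regular if all vertices have the same degree. A minimal counterexample to the Erd\H{o}s--Gy\'arf\'as conjecture is a graph \(G\) with \(\delta(G)\geq 3\) that contains no cycle whose length is a power of \(2\), chosen so that its number of vertices is minimum among all such graphs and, subject to that, its number of edges is minimum. -}

module Defs where

open import Data.Nat using (ℕ; zero; suc; _+_; _^_; _≤_; _<_; _<ᵇ_)
open import Data.Fin using (Fin; toℕ)
open import Data.Bool using (Bool; true; false; if_then_else_; _∧_)
open import Data.List using (List; map; allFin)
open import Data.Nat.ListAction using (sum)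
open import Data.Product using (Σ; ∃; _×_)
open import Data.Sum using (_⊎_)
open import Relation.Binary.PropositionalEquality using (_≡_)
open import Relation.Nullary using (¬_)
open import Function.Definitions using (Injective)

record Graph : Set where
  field
    n     : ℕ
    adj   : Fin n → Fin n → Bool
    sym   : ∀ u v → adj u v ≡ adj v u
    irref : ∀ v → adj v v ≡ false
open Graph public

Adj : (G : Graph) → Fin (n G) → Fin (n G) → Set
Adj G u v = adj G u v ≡ true

∣V∣ : Graph → ℕ
∣V∣ G = n G

deg : (G : Graph) → Fin (n G) → ℕ
deg G u = sum (map (λ v → if adj G u v then 1 else 0) (allFin (n G)))

∣E∣ : Graph → ℕ
∣E∣ G = sum (map (λ u → sum (map (λ v → if (toℕ u <ᵇ toℕ v) ∧ adj G u v then 1 else 0)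
                                 (allFin (n G))))
                 (allFin (n G)))

-- δ(G) ≥ 3 (graphs are taken to be nonempty, so δ(G) is defined)
δ≥3 : Graph → Set
δ≥3 G = (1 ≤ n G) × (∀ v → 3 ≤ deg G v)

HasCycleOfLength : (G : Graph) → ℕ → Set
HasCycleOfLength G k =
  (3 ≤ k) × Σ (Fin k → Fin (n G)) λ c →
    Injective _≡_ _≡_ c ×
    (∀ i j → (suc (toℕ i) ≡ toℕ j ⊎ (suc (toℕ i) ≡ k × toℕ j ≡ 0)) → Adj G (c i) (c j))

IsPowerOfTwo : ℕ → Set
IsPowerOfTwo k = ∃ λ m → k ≡ 2 ^ m

IsEGCounterexample : Graph → Set
IsEGCounterexample G = δ≥3 G × (∀ k → IsPowerOfTwo k → ¬ HasCycleOfLength G k)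

IsMinimalEGCounterexample : Graph → Set
IsMinimalEGCounterexample G =
  IsEGCounterexample G ×
  (∀ H → IsEGCounterexample H →
     (∣V∣ G < ∣V∣ H) ⊎ (∣V∣ G ≡ ∣V∣ H × ∣E∣ G ≤ ∣E∣ H))

IsRegular : Graph → Set
IsRegular G = ∃ λ d → ∀ v → deg G v ≡ d

IsCubic : Graph → Set
IsCubic G = ∀ v → deg G v ≡ 3

-- Deleting an edge keeps the vertex set, creates no cycles and lowers every
-- degree by at most one.  So if a counterexample had minimum degree at least 4,
-- deleting any edge would leave a counterexample with the same vertices and
-- fewer edges, contradicting minimality.  Hence a minimal counterexample has a
-- vertex of degree at most 3, and if it is regular it is cubic.
module Submission where

open import Defs
open import Data.Bool using (Bool; true; false; if_then_else_; _∧_; _∨_; not)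
open import Data.Bool.Properties using (∧-comm; ∨-comm; ∧-zeroʳ)
open import Data.Fin using (Fin; zero; suc; toℕ; fromℕ<; _≟_)
open import Data.Fin.Properties using (toℕ-injective)
open import Data.List using ([]; _∷_; map; allFin; tabulate)
open import Data.List.Membership.Propositional using (_∈_)
open import Data.List.Membership.Propositional.Properties using (∈-allFin)
open import Data.List.Properties using (map-tabulate)
open import Data.List.Relation.Unary.Any using (here; there)
open import Data.Nat using (ℕ; zero; suc; _+_; _≤_; _<_; _<ᵇ_; z≤n; s≤s; s≤s⁻¹)
open import Data.Nat.ListAction using (sum)
open import Data.Nat.Properties
  using (+-comm; +-commutativeSemigroup; ≤-refl; ≤-trans; ≤-antisym; <-irrefl; <-cmp; <⇒≱; ≰⇒>;
         +-mono-≤; +-monoʳ-≤; +-mono-<-≤; +-mono-≤-<; <⇒<ᵇ; module ≤-Reasoning)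
open import Algebra.Properties.CommutativeSemigroup +-commutativeSemigroup using (interchange)
open import Data.Product using (∃; _,_)
open import Data.Sum using (inj₁; inj₂)
open import Function using (id)
open import Relation.Binary.Definitions using (tri<; tri≈; tri>)
open import Relation.Binary.PropositionalEquality as ≡ using (_≡_; _≢_; refl; cong; cong₂; trans; subst)
open import Relation.Nullary using (¬_; yes; no; does; contradiction)
open import Relation.Nullary.Decidable using (dec-true)

indicator : Bool → ℕ
indicator b = if b then 1 else 0

indicator-mono : ∀ {a b} → (a ≡ true → b ≡ true) → indicator a ≤ indicator b
indicator-mono {false} a⇒b = z≤n
indicator-mono {true} a⇒b rewrite a⇒b refl = ≤-refl

indicator-∧-not : ∀ a b → indicator a ≤ indicator (a ∧ not b) + indicator b
indicator-∧-not false b     = z≤n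
indicator-∧-not true  false = ≤-refl
indicator-∧-not true  true  = ≤-refl

module _ {A : Set} where

  sum-map-mono : {f g : A → ℕ} → (∀ x → f x ≤ g x) →
                 ∀ xs → sum (map f xs) ≤ sum (map g xs)
  sum-map-mono f≤g []       = z≤n
  sum-map-mono f≤g (x ∷ xs) = +-mono-≤ (f≤g x) (sum-map-mono f≤g xs)

  sum-map-mono-< : {f g : A → ℕ} → (∀ x → f x ≤ g x) →
                   ∀ {x xs} → x ∈ xs → f x < g x → sum (map f xs) < sum (map g xs)
  sum-map-mono-< f≤g {xs = _ ∷ xs} (here refl) fx<gx =
    +-mono-<-≤ fx<gx (sum-map-mono f≤g xs)
  sum-map-mono-< f≤g {xs = y ∷ _}  (there x∈xs) fx<gx =
    +-mono-≤-< (f≤g y) (sum-map-mono-< f≤g x∈xs fx<gx)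

  sum-map-+ : (f g : A → ℕ) →
              ∀ xs → sum (map (λ x → f x + g x) xs) ≡ sum (map f xs) + sum (map g xs)
  sum-map-+ f g []       = refl
  sum-map-+ f g (x ∷ xs) =
    trans (cong (f x + g x +_) (sum-map-+ f g xs)) (interchange (f x) (g x) _ _)

  sum-indicator-pos : (b : A → Bool) →
                      ∀ xs → 0 < sum (map (λ x → indicator (b x)) xs) → ∃ λ x → b x ≡ true
  sum-indicator-pos b (x ∷ xs) pos with b x in bx
  ... | true  = x , bx
  ... | false = sum-indicator-pos b xs pos

sum-tabulate-0 : ∀ n → sum (tabulate {n = n} (λ _ → 0)) ≡ 0
sum-tabulate-0 zero    = refl
sum-tabulate-0 (suc n) = sum-tabulate-0 n

sum-tabulate-≟ : ∀ {n} (w : Fin n) → sum (tabulate (λ y → indicator (does (y ≟ w)))) ≡ 1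
sum-tabulate-≟ {suc n} zero    = cong suc (sum-tabulate-0 n)
sum-tabulate-≟ {suc n} (suc w) = sum-tabulate-≟ w

sum-allFin-≟ : ∀ {n} (w : Fin n) → sum (map (λ y → indicator (does (y ≟ w))) (allFin n)) ≡ 1
sum-allFin-≟ {n} w =
  trans (cong sum (map-tabulate {n = n} id (λ y → indicator (does (y ≟ w))))) (sum-tabulate-≟ w)

deg-pos⇒neighbour : (G : Graph) (x : Fin (n G)) → 0 < deg G x → ∃ (Adj G x)
deg-pos⇒neighbour G x = sum-indicator-pos (adj G x) (allFin (n G))

Adj⇒≢ : (G : Graph) {x y : Fin (n G)} → Adj G x y → x ≢ y
Adj⇒≢ G {x} x~y refl with trans (≡.sym x~y) (irref G x)
... | ()

samePair : ∀ {m} → Fin m → Fin m → Fin m → Fin m → Bool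
samePair u v x y = (does (x ≟ u) ∧ does (y ≟ v)) ∨ (does (x ≟ v) ∧ does (y ≟ u))

samePair-sym : ∀ {m} (u v x y : Fin m) → samePair u v x y ≡ samePair u v y x
samePair-sym u v x y =
  trans (∨-comm (does (x ≟ u) ∧ does (y ≟ v)) _)
        (cong₂ _∨_ (∧-comm (does (x ≟ v)) _) (∧-comm (does (x ≟ u)) _))

samePair-refl : ∀ {m} (u v : Fin m) → samePair u v u v ≡ true
samePair-refl u v rewrite dec-true (u ≟ u) refl | dec-true (v ≟ v) refl = refl

otherEnd : ∀ {m} → Fin m → Fin m → Fin m → Fin m
otherEnd u v x = if does (x ≟ u) then v else u

samePair⇒otherEnd : ∀ {m} (u v x y : Fin m) → samePair u v x y ≡ true → y ≡ otherEnd u v x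
samePair⇒otherEnd u v x y p with x ≟ u | y ≟ v | x ≟ v | y ≟ u
... | yes _    | yes y≡v | _        | _       = y≡v
... | yes x≡u  | no _    | yes x≡v  | yes y≡u = trans y≡u (trans (≡.sym x≡u) x≡v)
... | no _     | _       | yes _    | yes y≡u = y≡u
samePair⇒otherEnd u v x y () | yes _ | no _ | no _  | _
samePair⇒otherEnd u v x y () | yes _ | no _ | yes _ | no _
samePair⇒otherEnd u v x y () | no _  | _    | no _  | _
samePair⇒otherEnd u v x y () | no _  | _    | yes _ | no _

removeEdge : (G : Graph) → Fin (n G) → Fin (n G) → Graph
removeEdge G u v = record
  { n     = n G
  ; adj   = λ x y → adj G x y ∧ not (samePair u v x y)
  ; sym   = λ x y → cong₂ (λ a b → a ∧ not b) (Graph.sym G x y) (samePair-sym u v x y)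
  ; irref = λ x → cong (_∧ not (samePair u v x x)) (irref G x)
  }

module _ (G : Graph) {u v : Fin (n G)} where

  private
    G-uv : Graph
    G-uv = removeEdge G u v

  removeEdge-⊆ : ∀ {x y} → Adj G-uv x y → Adj G x y
  removeEdge-⊆ {x} {y} x~y with adj G x y
  ... | true = refl

  removeEdge-removes : adj G-uv u v ≡ false
  removeEdge-removes rewrite samePair-refl u v = ∧-zeroʳ (adj G u v)

  removeEdge-cycle : ∀ {k} → HasCycleOfLength G-uv k → HasCycleOfLength G k
  removeEdge-cycle (k≥3 , c , c-injective , c-adj) =
    k≥3 , c , c-injective , λ i j succ → removeEdge-⊆ (c-adj i j succ)

  deg-removeEdge : ∀ x → deg G x ≤ deg G-uv x + 1
  deg-removeEdge x = begin
    deg G x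
      ≤⟨ sum-map-mono dropped-≤ (allFin (n G)) ⟩
    sum (map (λ y → indicator (adj G-uv x y) + indicator (does (y ≟ otherEnd u v x)))
             (allFin (n G)))
      ≡⟨ sum-map-+ _ _ (allFin (n G)) ⟩
    deg G-uv x + sum (map (λ y → indicator (does (y ≟ otherEnd u v x))) (allFin (n G)))
      ≡⟨ cong (deg G-uv x +_) (sum-allFin-≟ (otherEnd u v x)) ⟩
    deg G-uv x + 1 ∎
    where
    open ≤-Reasoning
    -- at x, the only neighbour that can be lost is otherEnd u v x
    dropped-≤ : ∀ y → indicator (adj G x y)
                    ≤ indicator (adj G-uv x y) + indicator (does (y ≟ otherEnd u v x))
    dropped-≤ y = ≤-trans (indicator-∧-not (adj G x y) (samePair u v x y))
                          (+-monoʳ-≤ _ (indicator-mono λ uv≡xy →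
                            dec-true (y ≟ otherEnd u v x) (samePair⇒otherEnd u v x y uv≡xy)))

  ∣E∣-removeEdge-at : ∀ {a b} → toℕ a < toℕ b → Adj G a b → adj G-uv a b ≡ false →
                      ∣E∣ G-uv < ∣E∣ G
  ∣E∣-removeEdge-at {a} {b} a<b a~b a≁b =
    sum-map-mono-< (λ x → sum-map-mono (term-≤ x) (allFin (n G))) (∈-allFin a)
      (sum-map-mono-< (term-≤ a) (∈-allFin b) term-<)
    where
    term-≤ : ∀ x y → indicator ((toℕ x <ᵇ toℕ y) ∧ adj G-uv x y)
                   ≤ indicator ((toℕ x <ᵇ toℕ y) ∧ adj G x y)
    term-≤ x y with toℕ x <ᵇ toℕ y
    ... | false = z≤n
    ... | true  = indicator-mono removeEdge-⊆

    term-< : indicator ((toℕ a <ᵇ toℕ b) ∧ adj G-uv a b)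
           < indicator ((toℕ a <ᵇ toℕ b) ∧ adj G a b)
    term-< with toℕ a <ᵇ toℕ b | <⇒<ᵇ a<b
    ... | true | _ rewrite a~b | a≁b = s≤s z≤n

∣E∣-removeEdge : (G : Graph) {u v : Fin (n G)} → Adj G u v → ∣E∣ (removeEdge G u v) < ∣E∣ G
∣E∣-removeEdge G {u} {v} u~v with <-cmp (toℕ u) (toℕ v)
... | tri< u<v _ _ = ∣E∣-removeEdge-at G u<v u~v (removeEdge-removes G)
... | tri≈ _ u≡v _ = contradiction (toℕ-injective u≡v) (Adj⇒≢ G u~v)
... | tri> _ _ v<u = ∣E∣-removeEdge-at G v<u (trans (Graph.sym G v u) u~v)
                       (trans (Graph.sym (removeEdge G u v) v u) (removeEdge-removes G))

removeEdge-counterexample : (G : Graph) {u v : Fin (n G)} →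
                            IsEGCounterexample G → (∀ x → 4 ≤ deg G x) →
                            IsEGCounterexample (removeEdge G u v)
removeEdge-counterexample G ((n≥1 , _) , no-cycle) δ≥4 =
  (n≥1 , λ x → s≤s⁻¹ (subst (4 ≤_) (+-comm _ 1) (≤-trans (δ≥4 x) (deg-removeEdge G x)))) ,
  λ k k≡2^m cycle → no-cycle k k≡2^m (removeEdge-cycle G cycle)

minimal⇒edge-irremovable : (G : Graph) {u v : Fin (n G)} → IsMinimalEGCounterexample G →
                           IsEGCounterexample (removeEdge G u v) → ¬ Adj G u v
minimal⇒edge-irremovable G {u} {v} (_ , minimal) cx u~v with minimal (removeEdge G u v) cx
... | inj₁ n<n        = <-irrefl refl n<n
... | inj₂ (_ , E≤E′) = <⇒≱ (∣E∣-removeEdge G u~v) E≤E′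

minimal⇒¬δ≥4 : (G : Graph) → IsMinimalEGCounterexample G → ¬ (∀ x → 4 ≤ deg G x)
minimal⇒¬δ≥4 G M@(cx@((n≥1 , _) , _) , _) δ≥4
  with deg-pos⇒neighbour G (fromℕ< n≥1) (≤-trans (s≤s z≤n) (δ≥4 _))
... | _ , x~y = minimal⇒edge-irremovable G M (removeEdge-counterexample G cx δ≥4) x~y

corollary0p2 : (G : Graph) → IsRegular G → IsMinimalEGCounterexample G → IsCubic G
corollary0p2 G (d , deg≡d) M@(((_ , δ≥3) , _) , _) x =
  trans (deg≡d x) (≤-antisym d≤3 (subst (3 ≤_) (deg≡d x) (δ≥3 x)))
  where
  d≤3 : d ≤ 3
  d≤3 = s≤s⁻¹ (≰⇒> λ 4≤d → minimal⇒¬δ≥4 G M λ y → subst (4 ≤_) (≡.sym (deg≡d y)) 4≤d)
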